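{- For every rational number $\alpha\in(0,1)$ there is a set $E_\alpha\subseteq\mathbb{N}$ such that for infinitely many positive integers $n$ (with $n^\alpha$ and $n^{1-\alpha}$ integers) we have $$(n^{\alpha})!^{\,n^{1-\alpha}}\le T(n,E_\alpha)\le\frac{n!}{(n^{1-\alpha})!^{\,n^{\alpha}}}$$ and $$(n^{1-\alpha})!^{\,n^{\alpha}}\le T(n,\mathbb{N}\setminus E_\alpha)\le\frac{n!}{(n^{\alpha})!^{\,n^{1-\alpha}}}.$$
   Context: Here $\mathbb{N}=\{1,2,3,\dots\}$ and $[n]=\{1,\dots,n\}$. For $D\subseteq\mathbb{N}$, two permutations $\pi,\sigma$ of $[n]$ are called $G(D)$-different if there is a position $i\in[n]$ with $|\pi(i)-\sigma(i)|\in D$. $T(n,D)$ denotes the maximum cardinality of a set of permutations of $[n]$ any two distinct members of which are $G(D)$-different. -}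

module Defs where

open import Level using (0ℓ)
open import Data.Nat using (ℕ; _!; _^_; _/_; _≤_; _<_; ∣_-_∣; NonZero)
open import Data.Nat.Properties using (m^n≢0; _!≢0)
open import Data.Fin using (Fin; toℕ)
open import Data.Fin.Permutation using (Permutation′; _⟨$⟩ʳ_)
open import Data.Product using (Σ; ∃; _×_)
open import Relation.Binary.PropositionalEquality using (_≢_)
open import Relation.Nullary using (¬_)
open import Relation.Unary using (Pred)

-- Subsets D ⊆ ℕ = {1,2,3,...} are predicates on Agda's ℕ that hold only of
-- positive numbers (positivity is imposed where such sets are introduced).

Compl : Pred ℕ 0ℓ → Pred ℕ 0ℓ
Compl E d = (0 < d) × ¬ E d

GDiff : ∀ {n} → Pred ℕ 0ℓ → Permutation′ n → Permutation′ n → Set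
GDiff {n} D π σ = Σ (Fin n) λ i → D ∣ toℕ (π ⟨$⟩ʳ i) - toℕ (σ ⟨$⟩ʳ i) ∣

IsGDCode : (n : ℕ) → Pred ℕ 0ℓ → (m : ℕ) → (Fin m → Permutation′ n) → Set
IsGDCode n D m f = ∀ (i j : Fin m) → i ≢ j → GDiff D (f i) (f j)

-- L ≤ T(n,D): there is such a family of L permutations
-- (members are pairwise distinct automatically, since D ⊆ {1,2,...})
T≥ : ℕ → Pred ℕ 0ℓ → ℕ → Set
T≥ n D L = Σ (Fin L → Permutation′ n) (IsGDCode n D L)

T≤ : ℕ → Pred ℕ 0ℓ → ℕ → Set
T≤ n D U = ∀ (m : ℕ) (f : Fin m → Permutation′ n) → IsGDCode n D m f → m ≤ U

-- n! / ((k!)^l)   (integer division; exact here as it is a multinomial coefficient)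
quot : ℕ → ℕ → ℕ → ℕ
quot n k l = (n !) / ((k !) ^ l)
  where instance _ : NonZero (k !)
                 _ = k !≢0
                 _ : NonZero ((k !) ^ l)
                 _ = m^n≢0 (k !) l

-- A block structure on [n] is a bijection of [n] with c blocks of s
-- cells each, such that distinct cells of one block lie at a distance in R.
--   * Permuting every block independently gives (s !) ^ c permutations, any
--     two of which are G(R)-different: T(n, D) ≥ (s !) ^ c whenever R ⊆ D.
--   * If D avoids 0 and R, composing a G(D)-code with these (s !) ^ c
--     permutations yields pairwise distinct permutations, so
--     T(n, D) ≤ n ! / (s !) ^ c  (permutations are counted by Lehmer codes).
-- For α = p / q take n = 2 ^ (N q) and let E be the set of d > 0 whose 2-adic
-- valuation is below p modulo q.  Reading points of [n] in binary, the bits at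
-- positions k with (k mod q) < p form the cell index and the remaining bits the
-- block number; two cells of a block first differ at such a position, so their
-- distance lies in E.  Swapping the roles of the bits gives the analogous
-- structure for ℕ ∖ E, and the four bounds follow with n ^ α = 2 ^ (N p).

module Submission where

open import Defs
open import Level using (0ℓ)
open import Data.Bool using (Bool; true; false; not; if_then_else_; T)
open import Data.Bool.Properties using (not-involutive)
open import Data.Fin using (Fin; zero; suc; toℕ; combine; remQuot; quotient; remainder; finToFun; funToFin; punchIn; _≟_)
open import Data.Fin.Permutation
  using (Permutation′; permutation; _⟨$⟩ʳ_; _⟨$⟩ˡ_; _≈_; _∘ₚ_; id; insert; remove; inverseʳ; inverseˡ; punchIn-permute; insert-punchIn)
open import Data.Fin.Properties
  using (¬∀⟶∃¬; pigeonhole; combine-injective; combine-remQuot; remQuot-combine; funToFin-finToFin; toℕ-combine; punchIn-injective)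
  renaming (<⇒≢ to <⇒≢ᶠ)
open import Data.Nat using (ℕ; zero; suc; _+_; _*_; _∸_; _^_; _!; _⊓_; _≤_; _<_; _<ᵇ_; ∣_-_∣; NonZero; z<s; s<s)
open import Data.Nat.Properties
  using ( +-comm; +-suc; +-identityʳ; *-comm; *-assoc; *-suc; *-cancelˡ-≡; *-distribˡ-∸; ^-*-assoc
        ; ∣-∣-comm; ∣m+n-m+o∣≡∣n-o∣; *-distribˡ-∣-∣; m≡n⇒∣m-n∣≡0; m+n∸m≡n; m≤n⇒m⊓n≡m; even≢odd
        ; <-irrefl; <⇒≤; ≤-trans; ≮⇒≥; +-mono-≤; m≤m+n; m≤m*n; m^n>0; m^n≢0; _!≢0; module ≤-Reasoning)
open import Data.Nat.DivMod using (_%_; _/_; m*n/n≡m; /-monoˡ-≤; [m+n]%n≡m%n; m<n⇒m%n≡m)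
open import Data.Product using (Σ; ∃; ∃₂; _×_; _,_; proj₁; proj₂; uncurry)
open import Function using (_∘_)
open import Relation.Binary.PropositionalEquality
  using (_≡_; _≢_; _≗_; refl; sym; trans; cong; cong₂; subst; subst₂; module ≡-Reasoning)
open import Relation.Nullary using (¬_; yes; no; contradiction)
open import Relation.Unary using (Pred; _⊆_)

private
  variable
    n m c s : ℕ
    R D : Pred ℕ 0ℓ

apart : (f g : Fin n → Fin m) → ¬ (f ≗ g) → ∃ λ i → f i ≢ g i
apart {n} f g f≉g = ¬∀⟶∃¬ n (λ i → f i ≡ g i) (λ i → f i ≟ g i) f≉g

remQuot-injective : ∀ k (x y : Fin (m * k)) → remQuot {m} k x ≡ remQuot k y → x ≡ y
remQuot-injective {m} k x y eq = begin
  x                          ≡⟨ combine-remQuot {m} k x ⟨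
  uncurry combine (remQuot {m} k x) ≡⟨ cong (uncurry combine) eq ⟩
  uncurry combine (remQuot {m} k y) ≡⟨ combine-remQuot {m} k y ⟩
  y                          ∎
  where open ≡-Reasoning

funToFin-cong : {f g : Fin n → Fin m} → f ≗ g → funToFin f ≡ funToFin g
funToFin-cong {zero} f≗g = refl
funToFin-cong {suc n} f≗g = cong₂ combine (f≗g zero) (funToFin-cong (f≗g ∘ suc))

finToFun-apart : {x y : Fin (m ^ n)} → x ≢ y → ∃ λ i → finToFun {m} {n} x i ≢ finToFun y i
finToFun-apart {m} {n} {x} {y} x≢y = apart (finToFun {m} {n} x) (finToFun y) λ x≗y →
  x≢y (trans (sym (funToFin-finToFin {n} {m} x))
        (trans (funToFin-cong x≗y) (funToFin-finToFin {n} {m} y)))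

-- Lehmer code: a permutation π of [1 + n] is determined by π 0 together with the
-- permutation of [n] left after removing 0; iterating gives a code in Fin (n !).
lehmer : Permutation′ n → Fin (n !)
lehmer {zero} π = zero
lehmer {suc n} π = combine (π ⟨$⟩ʳ zero) (lehmer (remove zero π))

lehmer-injective : (π σ : Permutation′ n) → lehmer π ≡ lehmer σ → π ≈ σ
lehmer-injective {suc n} π σ eq = agree
  where
  open ≡-Reasoning
  same-head,tail : π ⟨$⟩ʳ zero ≡ σ ⟨$⟩ʳ zero × lehmer (remove zero π) ≡ lehmer (remove zero σ)
  same-head,tail = combine-injective (π ⟨$⟩ʳ zero) (lehmer (remove zero π))
                                     (σ ⟨$⟩ʳ zero) (lehmer (remove zero σ)) eq
  agree : π ≈ σ
  agree zero = proj₁ same-head,tail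
  agree (suc i) = begin
    π ⟨$⟩ʳ suc i                                  ≡⟨ punchIn-permute π zero i ⟩
    punchIn (π ⟨$⟩ʳ zero) (remove zero π ⟨$⟩ʳ i) ≡⟨ cong₂ punchIn (proj₁ same-head,tail)
                                                      (lehmer-injective _ _ (proj₂ same-head,tail) i) ⟩
    punchIn (σ ⟨$⟩ʳ zero) (remove zero σ ⟨$⟩ʳ i) ≡⟨ punchIn-permute σ zero i ⟨
    σ ⟨$⟩ʳ suc i                                  ∎

distinct-permutations : ∀ {K} (f : Fin K → Permutation′ n) →
  (∀ i j → i ≢ j → ¬ f i ≈ f j) → K ≤ n !
distinct-permutations f distinct = ≮⇒≥ λ n!<K →
  let (i , j , i<j , same-code) = pigeonhole n!<K (lehmer ∘ f)
  in distinct i j (<⇒≢ᶠ i<j) (lehmer-injective (f i) (f j) same-code)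

unlehmer : Fin (n !) → Permutation′ n
unlehmer {zero} _ = id
unlehmer {suc n} x = insert zero head (unlehmer tail)
  where
  head : Fin (suc n)
  head = proj₁ (remQuot {suc n} (n !) x)
  tail : Fin (n !)
  tail = proj₂ (remQuot {suc n} (n !) x)

insert-injective : ∀ {i j} (ρ τ : Permutation′ n) →
  insert zero i ρ ≈ insert zero j τ → i ≡ j × ρ ≈ τ
insert-injective {i = i} {j} ρ τ same = same zero , λ k → punchIn-injective i _ _ (begin
  punchIn i (ρ ⟨$⟩ʳ k)           ≡⟨ insert-punchIn zero i ρ k ⟨
  insert zero i ρ ⟨$⟩ʳ suc k     ≡⟨ same (suc k) ⟩
  insert zero j τ ⟨$⟩ʳ suc k     ≡⟨ insert-punchIn zero j τ k ⟩
  punchIn j (τ ⟨$⟩ʳ k)           ≡⟨ cong (λ l → punchIn l (τ ⟨$⟩ʳ k)) (same zero) ⟨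
  punchIn i (τ ⟨$⟩ʳ k)           ∎)
  where open ≡-Reasoning

unlehmer-injective : (x y : Fin (n !)) → unlehmer x ≈ unlehmer y → x ≡ y
unlehmer-injective {zero} zero zero _ = refl
unlehmer-injective {suc n} x y same =
  remQuot-injective (n !) x y
    (cong₂ _,_ (proj₁ same-head,tail) (unlehmer-injective {n} (tail x) (tail y) (proj₂ same-head,tail)))
  where
  head : Fin (suc n !) → Fin (suc n)
  head z = proj₁ (remQuot {suc n} (n !) z)
  tail : Fin (suc n !) → Fin (n !)
  tail z = proj₂ (remQuot {suc n} (n !) z)
  same-head,tail : head x ≡ head y × unlehmer (tail x) ≈ unlehmer (tail y)
  same-head,tail = insert-injective {n} (unlehmer (tail x)) (unlehmer (tail y)) same

gap : Fin n → Fin n → ℕ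
gap x y = ∣ toℕ x - toℕ y ∣

record Blocks (n c s : ℕ) (R : Pred ℕ 0ℓ) : Set where
  field
    cell  : Fin c → Fin s → Fin n
    block : Fin n → Fin c
    index : Fin n → Fin s
    block-cell       : ∀ k u → block (cell k u) ≡ k
    index-cell       : ∀ k u → index (cell k u) ≡ u
    cell-block-index : ∀ x → cell (block x) (index x) ≡ x
    internal         : ∀ k {u v} → u ≢ v → R (gap (cell k u) (cell k v))

  same-block : ∀ {x y} → block x ≡ block y → x ≢ y → R (gap x y)
  same-block {x} {y} bx≡by x≢y =
    subst₂ (λ a b → R (gap a b)) (cell-block-index x) y′≡y (internal (block x) ix≢iy)
    where
    y′≡y : cell (block x) (index y) ≡ y
    y′≡y = trans (cong (λ k → cell k (index y)) bx≡by) (cell-block-index y)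
    ix≢iy : index x ≢ index y
    ix≢iy ix≡iy = x≢y (trans (sym (cell-block-index x)) (trans (cong (cell (block x)) ix≡iy) y′≡y))

  act : (Fin c → Fin s → Fin s) → Fin n → Fin n
  act τ x = cell (block x) (τ (block x) (index x))

  act-cell : ∀ τ k u → act τ (cell k u) ≡ cell k (τ k u)
  act-cell τ k u = cong₂ (λ k′ u′ → cell k′ (τ k′ u′)) (block-cell k u) (index-cell k u)

  act-block : ∀ τ x → block (act τ x) ≡ block x
  act-block τ x = block-cell (block x) _

  act-inverse : ∀ τ τ′ → (∀ k u → τ k (τ′ k u) ≡ u) → ∀ x → act τ (act τ′ x) ≡ x
  act-inverse τ τ′ inv x = begin
    act τ (act τ′ x)                                       ≡⟨ act-cell τ (block x) _ ⟩
    cell (block x) (τ (block x) (τ′ (block x) (index x))) ≡⟨ cong (cell (block x)) (inv (block x) (index x)) ⟩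
    cell (block x) (index x)                               ≡⟨ cell-block-index x ⟩
    x                                                      ∎
    where open ≡-Reasoning

  blockwise : (Fin c → Permutation′ s) → Permutation′ n
  blockwise σ = permutation (act forward) (act backward)
    (act-inverse forward backward λ k u → inverseʳ (σ k))
    (act-inverse backward forward λ k u → inverseˡ (σ k))
    where
    forward backward : Fin c → Fin s → Fin s
    forward k = σ k ⟨$⟩ʳ_
    backward k = σ k ⟨$⟩ˡ_

  -- If two blockwise permutations send x and y to the same point, then x and y
  -- share a block; so x = y or their distance lies in R.
  blockwise-collision : ∀ σ τ {x y} → blockwise σ ⟨$⟩ʳ x ≡ blockwise τ ⟨$⟩ʳ y → x ≢ y → R (gap x y)
  blockwise-collision σ τ {x} {y} eq = same-block (begin
    block x                       ≡⟨ act-block (λ k → σ k ⟨$⟩ʳ_) x ⟨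
    block (blockwise σ ⟨$⟩ʳ x)  ≡⟨ cong block eq ⟩
    block (blockwise τ ⟨$⟩ʳ y)  ≡⟨ act-block (λ k → τ k ⟨$⟩ʳ_) y ⟩
    block y                       ∎)
    where open ≡-Reasoning

  -- All (s !) ^ c blockwise permutations: code x picks the Lehmer code of the
  -- permutation used on each block.
  choice : Fin ((s !) ^ c) → Fin c → Permutation′ s
  choice x k = unlehmer (finToFun x k)

  family : Fin ((s !) ^ c) → Permutation′ n
  family x = blockwise (choice x)

  family-cell : ∀ x k u → family x ⟨$⟩ʳ cell k u ≡ cell k (choice x k ⟨$⟩ʳ u)
  family-cell x k u = act-cell (λ k → choice x k ⟨$⟩ʳ_) k u

  choice-apart : ∀ {x y} → x ≢ y → ∃₂ λ k u → choice x k ⟨$⟩ʳ u ≢ choice y k ⟨$⟩ʳ u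
  choice-apart {x} {y} x≢y =
    let (k , codes≢) = finToFun-apart x≢y
        (u , images≢) = apart (choice x k ⟨$⟩ʳ_) (choice y k ⟨$⟩ʳ_) (codes≢ ∘ unlehmer-injective _ _)
    in k , u , images≢

module _ {n c s R} (B : Blocks n c s R) where
  open Blocks B

  -- Lower bound: the blockwise permutations are pairwise G(D)-different as soon
  -- as R ⊆ D, since two of them differ inside some block.
  lower-bound : R ⊆ D → T≥ n D ((s !) ^ c)
  lower-bound {D} R⊆D = family , separated
    where
    separated : IsGDCode n D ((s !) ^ c) family
    separated x y x≢y =
      let (k , u , images≢) = choice-apart x≢y
      in cell k u , R⊆D (subst₂ (λ a b → R (gap a b))
                           (sym (family-cell x k u)) (sym (family-cell y k u)) (internal k images≢))

  -- Composing the members of a G(D)-code with the blockwise permutations gives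
  -- pairwise distinct permutations of [n], provided D avoids 0 and R: within a
  -- code member the blockwise permutations differ, and two different code
  -- members are sent apart by a D-distance, which no blockwise move can undo.
  module _ {D m} (D-positive : ∀ d → D d → 0 < d) (D∩R=∅ : ∀ d → D d → ¬ R d)
           (f : Fin m → Permutation′ n) (code : IsGDCode n D m f) where

    compose : Fin m × Fin ((s !) ^ c) → Permutation′ n
    compose (i , x) = f i ∘ₚ family x

    compose-distinct : ∀ a b → a ≢ b → ¬ compose a ≈ compose b
    compose-distinct (i , x) (j , y) a≢b same with i ≟ j
    ... | yes refl =
      let (k , u , images≢) = choice-apart (λ x≡y → a≢b (cong (i ,_) x≡y))
          z = f i ⟨$⟩ˡ cell k u
      in images≢ (begin
        choice x k ⟨$⟩ʳ u                    ≡⟨ index-cell k _ ⟨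
        index (cell k (choice x k ⟨$⟩ʳ u))    ≡⟨ cong index (family-cell x k u) ⟨
        index (family x ⟨$⟩ʳ cell k u)        ≡⟨ cong (λ t → index (family x ⟨$⟩ʳ t)) (inverseʳ (f i)) ⟨
        index (family x ⟨$⟩ʳ (f i ⟨$⟩ʳ z))  ≡⟨ cong index (same z) ⟩
        index (family y ⟨$⟩ʳ (f i ⟨$⟩ʳ z))  ≡⟨ cong (λ t → index (family y ⟨$⟩ʳ t)) (inverseʳ (f i)) ⟩
        index (family y ⟨$⟩ʳ cell k u)        ≡⟨ cong index (family-cell y k u) ⟩
        index (cell k (choice y k ⟨$⟩ʳ u))    ≡⟨ index-cell k _ ⟩
        choice y k ⟨$⟩ʳ u                    ∎)
      where open ≡-Reasoning
    ... | no i≢j with code i j i≢j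
    ... | t , D-gap with f i ⟨$⟩ʳ t ≟ f j ⟨$⟩ʳ t
    ...   | yes equal = <-irrefl (sym (m≡n⇒∣m-n∣≡0 (cong toℕ equal))) (D-positive _ D-gap)
    ...   | no unequal = D∩R=∅ _ D-gap (blockwise-collision (choice x) (choice y) (same t) unequal)

  upper-bound : (∀ d → D d → 0 < d) → (∀ d → D d → ¬ R d) → T≤ n D (quot n s c)
  upper-bound D-positive D∩R=∅ m f code = begin
    m                  ≡⟨ m*n/n≡m m P ⟨
    m * P / P          ≤⟨ /-monoˡ-≤ P (distinct-permutations composite composite-distinct) ⟩
    (n !) / P          ∎
    where
    open ≤-Reasoning
    P : ℕ
    P = (s !) ^ c
    instance
      P≢0 : NonZero P
      P≢0 = m^n≢0 (s !) c {{s !≢0}}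
    composite : Fin (m * P) → Permutation′ n
    composite = compose D-positive D∩R=∅ f code ∘ remQuot P
    composite-distinct : ∀ a b → a ≢ b → ¬ composite a ≈ composite b
    composite-distinct a b a≢b =
      compose-distinct D-positive D∩R=∅ f code _ _ (a≢b ∘ remQuot-injective P a b)

combine-bit₀ : (x : Fin m) → toℕ (combine {n = 2} x zero) ≡ 2 * toℕ x
combine-bit₀ x = trans (toℕ-combine x zero) (+-identityʳ _)

combine-bit₁ : (x : Fin m) → toℕ (combine {n = 2} x (suc zero)) ≡ suc (2 * toℕ x)
combine-bit₁ x = trans (toℕ-combine x (suc zero)) (+-comm _ 1)

gap-same-bit : (x y : Fin m) (b : Fin 2) → gap (combine x b) (combine y b) ≡ 2 * gap x y
gap-same-bit x y b = begin
  gap (combine x b) (combine y b)              ≡⟨ cong₂ ∣_-_∣ (toℕ-combine x b) (toℕ-combine y b) ⟩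
  ∣ 2 * toℕ x + toℕ b - 2 * toℕ y + toℕ b ∣ ≡⟨ cong₂ ∣_-_∣ (+-comm (2 * toℕ x) (toℕ b)) (+-comm (2 * toℕ y) (toℕ b)) ⟩
  ∣ toℕ b + 2 * toℕ x - toℕ b + 2 * toℕ y ∣ ≡⟨ ∣m+n-m+o∣≡∣n-o∣ (toℕ b) _ _ ⟩
  ∣ 2 * toℕ x - 2 * toℕ y ∣                   ≡⟨ *-distribˡ-∣-∣ 2 (toℕ x) (toℕ y) ⟨
  2 * gap x y                                  ∎
  where open ≡-Reasoning

even-odd-gap : ∀ a b → ∃ λ o → ∣ 2 * a - suc (2 * b) ∣ ≡ suc (2 * o)
even-odd-gap zero b = b , refl
even-odd-gap (suc a) zero = a , cong (λ t → ∣ t - 1 ∣) (*-suc 2 a)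
even-odd-gap (suc a) (suc b) =
  let (o , odd) = even-odd-gap a b
  in o , trans (cong₂ (λ t u → ∣ t - suc u ∣) (*-suc 2 a) (*-suc 2 b)) odd

gap-other-bit : (x y : Fin m) {b b′ : Fin 2} → b ≢ b′ →
  ∃ λ o → gap (combine x b) (combine y b′) ≡ suc (2 * o)
gap-other-bit x y {zero} {zero} b≢b′ = contradiction refl b≢b′
gap-other-bit x y {suc zero} {suc zero} b≢b′ = contradiction refl b≢b′
gap-other-bit x y {zero} {suc zero} _ =
  let (o , odd) = even-odd-gap (toℕ x) (toℕ y)
  in o , trans (cong₂ ∣_-_∣ (combine-bit₀ x) (combine-bit₁ y)) odd
gap-other-bit x y {suc zero} {zero} _ =
  let (o , odd) = even-odd-gap (toℕ y) (toℕ x)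
  in o , trans (cong₂ ∣_-_∣ (combine-bit₁ x) (combine-bit₀ y))
               (trans (∣-∣-comm (suc (2 * toℕ x)) (2 * toℕ y)) odd)

high : ∀ m → Fin (m * 2) → Fin m
high m = quotient {m} 2

low : ∀ m → Fin (m * 2) → Fin 2
low m = remainder {m} 2

high-combine : (y : Fin m) (b : Fin 2) → high m (combine y b) ≡ y
high-combine y b = cong proj₁ (remQuot-combine y b)

low-combine : (y : Fin m) (b : Fin 2) → low m (combine y b) ≡ b
low-combine y b = cong proj₂ (remQuot-combine y b)

combine-high-low : ∀ m (x : Fin (m * 2)) → combine (high m x) (low m x) ≡ x
combine-high-low m = combine-remQuot {m} 2

module _ {n c s R} (B : Blocks n c s R) {R′ : Pred ℕ 0ℓ} (double : ∀ {d} → R d → R′ (2 * d)) where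
  open Blocks B

  same-bit : ∀ {k} (b : Fin 2) {u v} → u ≢ v → R′ (gap (combine (cell k u) b) (combine (cell k v) b))
  same-bit {k} b {u} {v} u≢v =
    subst R′ (sym (gap-same-bit (cell k u) (cell k v) b)) (double (internal k u≢v))

  -- The low bit becomes the lowest bit of the cell index: the c blocks double in
  -- size, and two cells of a block have different low bits (odd distance) or
  -- equal low bits and distinct high parts in a common old block.
  bit-to-index : (∀ o → R′ (suc (2 * o))) → Blocks (n * 2) c (s * 2) R′
  bit-to-index odd = record
    { cell  = λ k w → combine (cell k (high s w)) (low s w)
    ; block = λ x → block (high n x)
    ; index = λ x → combine (index (high n x)) (low n x)
    ; block-cell = λ k w → trans (cong block (high-combine _ _)) (block-cell k _)
    ; index-cell = λ k w → trans (cong₂ combine (trans (cong index (high-combine _ _)) (index-cell k _))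
                                                (low-combine (cell k (high s w)) (low s w)))
                                 (combine-high-low s w)
    ; cell-block-index = λ x → trans (cong₂ combine (trans (cong (cell _) (high-combine _ _)) (cell-block-index _))
                                                    (low-combine (index (high n x)) (low n x)))
                                     (combine-high-low n x)
    ; internal = λ k {w} {w′} w≢w′ → apart-bits (w≢w′ ∘ remQuot-injective {s} 2 w w′)
    }
    where
    apart-bits : ∀ {k u v} {b b′ : Fin 2} → (u , b) ≢ (v , b′) →
                 R′ (gap (combine (cell k u) b) (combine (cell k v) b′))
    apart-bits {k} {u} {v} {b} {b′} ub≢vb′ with b ≟ b′
    ... | yes refl = same-bit b (λ u≡v → ub≢vb′ (cong (_, b) u≡v))
    ... | no b≢b′  = let (o , odd-gap) = gap-other-bit (cell k u) (cell k v) b≢b′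
                     in subst R′ (sym odd-gap) (odd o)

  -- The low bit becomes the lowest bit of the block number: there are twice as
  -- many blocks, each a copy of an old block with a fixed low bit.
  bit-to-block : Blocks (n * 2) (c * 2) s R′
  bit-to-block = record
    { cell  = λ k′ u → combine (cell (high c k′) u) (low c k′)
    ; block = λ x → combine (block (high n x)) (low n x)
    ; index = λ x → index (high n x)
    ; block-cell = λ k′ u → trans (cong₂ combine (trans (cong block (high-combine _ _)) (block-cell _ u))
                                                 (low-combine (cell (high c k′) u) (low c k′)))
                                  (combine-high-low c k′)
    ; index-cell = λ k′ u → trans (cong index (high-combine _ _)) (index-cell _ u)
    ; cell-block-index = λ x → trans (cong₂ combine (trans (cong (λ k → cell k _) (high-combine _ _)) (cell-block-index _))
                                                    (low-combine (block (high n x)) (low n x)))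
                                     (combine-high-low n x)
    ; internal = λ k′ → same-bit (low c k′)
    }

point-blocks : Blocks 1 1 1 R
point-blocks = record
  { cell = λ _ _ → zero ; block = λ _ → zero ; index = λ _ → zero
  ; block-cell = λ { zero zero → refl } ; index-cell = λ { zero zero → refl }
  ; cell-block-index = λ { zero → refl }
  ; internal = λ { zero {zero} {zero} u≢v → contradiction refl u≢v }
  }

resize : ∀ {n′ c′ s′} → n ≡ n′ → c ≡ c′ → s ≡ s′ → Blocks n c s R → Blocks n′ c′ s′ R
resize refl refl refl B = B

-- Val k d: the 2-adic valuation of d > 0 is k, i.e. d = 2 ^ k * (odd number).
data Val : ℕ → ℕ → Set where
  odd   : ∀ o → Val 0 (suc (2 * o))
  twice : ∀ {k d} → Val k d → Val (suc k) (2 * d)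

Val-positive : ∀ {k d} → Val k d → 0 < d
Val-positive (odd o) = z<s
Val-positive (twice {d = zero} v) = contradiction (Val-positive v) (<-irrefl refl)
Val-positive (twice {d = suc d} v) = z<s

Val-functional : ∀ {k k′ d d′} → Val k d → Val k′ d′ → d ≡ d′ → k ≡ k′
Val-functional (odd o) (odd o′) _ = refl
Val-functional (odd o) (twice {d = d} v) eq = contradiction (sym eq) (even≢odd d o)
Val-functional (twice {d = d} v) (odd o) eq = contradiction eq (even≢odd d o)
Val-functional (twice {d = d} v) (twice {d = d′} v′) eq =
  cong suc (Val-functional v v′ (*-cancelˡ-≡ d d′ 2 eq))

Valued : (ℕ → Bool) → Pred ℕ 0ℓ
Valued P d = ∃ λ k → Val k d × T (P k)

ones : (ℕ → Bool) → ℕ → ℕ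
ones P zero = zero
ones P (suc r) = if P 0 then suc (ones (P ∘ suc) r) else ones (P ∘ suc) r

valued-twice : ∀ P {d} → Valued (P ∘ suc) d → Valued P (2 * d)
valued-twice P (k , v , Pk) = suc k , twice v , Pk

double-power : ∀ e → 2 ^ e * 2 ≡ 2 ^ suc e
double-power e = *-comm (2 ^ e) 2

-- Writing x ∈ [2 ^ r] in binary, a bit pattern P makes the bits at positions
-- in P the cell index and the others the block number.  Two cells of one block
-- first differ at a P-position, so their distance is P-valued.
pattern-blocks : ∀ P r → Blocks (2 ^ r) (2 ^ ones (not ∘ P) r) (2 ^ ones P r) (Valued P)
pattern-blocks P zero = point-blocks
pattern-blocks P (suc r) with P 0 in P0
... | true  = resize (double-power r) refl (double-power (ones (P ∘ suc) r))
                (bit-to-index (pattern-blocks (P ∘ suc) r) (valued-twice P)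
                              λ o → 0 , odd o , subst T (sym P0) _)
... | false = resize (double-power r) (double-power (ones (not ∘ P ∘ suc) r)) refl
                (bit-to-block (pattern-blocks (P ∘ suc) r) (valued-twice P))

ones-+ : ∀ P m r → ones P (m + r) ≡ ones P m + ones (λ i → P (m + i)) r
ones-+ P zero r = refl
ones-+ P (suc m) r with P 0
... | true  = cong suc (ones-+ (P ∘ suc) m r)
... | false = ones-+ (P ∘ suc) m r

ones-cong : ∀ {P P′} r → (∀ i → i < r → P i ≡ P′ i) → ones P r ≡ ones P′ r
ones-cong zero _ = refl
ones-cong {P} {P′} (suc r) P≡P′ rewrite P≡P′ 0 z<s =
  cong (λ t → if P′ 0 then suc t else t) (ones-cong r λ i i<r → P≡P′ (suc i) (s<s i<r))

ones-threshold : ∀ p r → ones (_<ᵇ p) r ≡ p ⊓ r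
ones-threshold zero    zero    = refl
ones-threshold zero    (suc r) = ones-threshold zero r
ones-threshold (suc p) zero    = refl
ones-threshold (suc p) (suc r) = cong suc (ones-threshold p r)

ones-not : ∀ P r → ones P r + ones (not ∘ P) r ≡ r
ones-not P zero = refl
ones-not P (suc r) with P 0
... | true  = cong suc (ones-not (P ∘ suc) r)
... | false = trans (+-suc _ _) (cong suc (ones-not (P ∘ suc) r))

periodic : (p Q : ℕ) .{{_ : NonZero Q}} → ℕ → Bool
periodic p Q k = k % Q <ᵇ p

ones-periodic : ∀ p Q .{{_ : NonZero Q}} → p ≤ Q → ∀ N → ones (periodic p Q) (N * Q) ≡ N * p
ones-periodic p Q p≤Q zero = refl
ones-periodic p Q p≤Q (suc N) = begin
  ones P (Q + N * Q)                          ≡⟨ ones-+ P Q (N * Q) ⟩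
  ones P Q + ones (λ i → P (Q + i)) (N * Q)   ≡⟨ cong₂ _+_ one-period (ones-cong (N * Q) λ i _ → shift i) ⟩
  p + ones P (N * Q)                          ≡⟨ cong (p +_) (ones-periodic p Q p≤Q N) ⟩
  p + N * p                                   ∎
  where
  open ≡-Reasoning
  P : ℕ → Bool
  P = periodic p Q
  shift : ∀ i → P (Q + i) ≡ P i
  shift i = cong (_<ᵇ p) (trans (cong (_% Q) (+-comm Q i)) ([m+n]%n≡m%n i Q))
  one-period : ones P Q ≡ p
  one-period = begin
    ones P Q          ≡⟨ ones-cong Q (λ i i<Q → cong (_<ᵇ p) (m<n⇒m%n≡m i<Q)) ⟩
    ones (_<ᵇ p) Q    ≡⟨ ones-threshold p Q ⟩
    p ⊓ Q             ≡⟨ m≤n⇒m⊓n≡m p≤Q ⟩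
    p                 ∎

ones-periodic-not : ∀ p Q .{{_ : NonZero Q}} → p ≤ Q → ∀ N →
  ones (not ∘ periodic p Q) (N * Q) ≡ N * (Q ∸ p)
ones-periodic-not p Q p≤Q N = begin
  ones (not ∘ P) r                    ≡⟨ m+n∸m≡n (ones P r) _ ⟨
  ones P r + ones (not ∘ P) r ∸ ones P r ≡⟨ cong₂ _∸_ (ones-not P r) (ones-periodic p Q p≤Q N) ⟩
  N * Q ∸ N * p                       ≡⟨ *-distribˡ-∸ N Q p ⟨
  N * (Q ∸ p)                         ∎
  where
  open ≡-Reasoning
  r : ℕ
  r = N * Q
  P : ℕ → Bool
  P = periodic p Q

valued-not : ∀ P {d} → Valued (not ∘ P) d → Compl (Valued P) d
valued-not P (k , v , ¬Pk) = Val-positive v , λ (k′ , v′ , Pk′) →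
  contradiction (subst (T ∘ P) (Val-functional v′ v refl) Pk′) (not-T (P k) ¬Pk)
  where
  not-T : ∀ b → T (not b) → ¬ T b
  not-T true  ()
  not-T false _ ()

valued-positive : ∀ P {d} → Valued P d → 0 < d
valued-positive P (k , v , _) = Val-positive v

periodic-blocks : ∀ p Q .{{_ : NonZero Q}} → p ≤ Q → ∀ N →
  Blocks (2 ^ (N * Q)) (2 ^ (N * (Q ∸ p))) (2 ^ (N * p)) (Valued (periodic p Q))
periodic-blocks p Q p≤Q N =
  resize refl (cong (2 ^_) (ones-periodic-not p Q p≤Q N)) (cong (2 ^_) (ones-periodic p Q p≤Q N))
    (pattern-blocks (periodic p Q) (N * Q))

periodic-blocks-not : ∀ p Q .{{_ : NonZero Q}} → p ≤ Q → ∀ N →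
  Blocks (2 ^ (N * Q)) (2 ^ (N * p)) (2 ^ (N * (Q ∸ p))) (Valued (not ∘ periodic p Q))
periodic-blocks-not p Q p≤Q N =
  resize refl (cong (2 ^_) (trans double-negation (ones-periodic p Q p≤Q N)))
              (cong (2 ^_) (ones-periodic-not p Q p≤Q N))
    (pattern-blocks (not ∘ periodic p Q) (N * Q))
  where
  double-negation : ones (not ∘ not ∘ periodic p Q) (N * Q) ≡ ones (periodic p Q) (N * Q)
  double-negation = ones-cong (N * Q) λ i _ → not-involutive (periodic p Q i)

-- (m ^ (N * x)) ^ y = (m ^ (N * y)) ^ x: with a = 2 ^ (N * p) and n = 2 ^ (N * q)
-- this says a ^ q = n ^ p.
power-swap : ∀ m N x y → (m ^ (N * x)) ^ y ≡ (m ^ (N * y)) ^ x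
power-swap m N x y = begin
  (m ^ (N * x)) ^ y  ≡⟨ ^-*-assoc m (N * x) y ⟩
  m ^ (N * x * y)    ≡⟨ cong (m ^_) (*-assoc N x y) ⟩
  m ^ (N * (x * y))  ≡⟨ cong (λ e → m ^ (N * e)) (*-comm x y) ⟩
  m ^ (N * (y * x))  ≡⟨ cong (m ^_) (*-assoc N y x) ⟨
  m ^ (N * y * x)    ≡⟨ ^-*-assoc m (N * y) x ⟨
  (m ^ (N * y)) ^ x  ∎
  where open ≡-Reasoning

n<2^n : ∀ n → n < 2 ^ n
n<2^n zero    = z<s
n<2^n (suc n) = +-mono-≤ (m^n>0 2 n) (≤-trans (n<2^n n) (m≤m+n (2 ^ n) 0))

theorem3 : (p q : ℕ) → 0 < p → p < q →
    Σ (Pred ℕ 0ℓ) λ E → (∀ d → E d → 0 < d) ×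
    (∀ (N : ℕ) → Σ ℕ λ n → N ≤ n × 0 < n × Σ ℕ λ a → Σ ℕ λ b →
    a ^ q ≡ n ^ p × b ^ q ≡ n ^ (q ∸ p) ×
    T≥ n E ((a !) ^ b) × T≤ n E (quot n b a) ×
    T≥ n (Compl E) ((b !) ^ a) × T≤ n (Compl E) (quot n a b))
theorem3 p q@(suc _) _ p<q = Valued P , (λ _ → valued-positive P) , λ N →
  let B = periodic-blocks p q p≤q N
      B′ = periodic-blocks-not p q p≤q N
  in 2 ^ (N * q) , ≤-trans (m≤m*n N q) (<⇒≤ (n<2^n (N * q))) , m^n>0 2 (N * q) ,
     2 ^ (N * p) , 2 ^ (N * (q ∸ p)) , power-swap 2 N p q , power-swap 2 N (q ∸ p) q ,
     lower-bound B (λ e → e) ,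
     upper-bound B′ (λ _ → valued-positive P) (λ _ e c → proj₂ (valued-not P c) e) ,
     lower-bound B′ (valued-not P) ,
     upper-bound B (λ _ → proj₁) (λ _ → proj₂)
  where
  P : ℕ → Bool
  P = periodic p q
  p≤q : p ≤ q
  p≤q = <⇒≤ p<q
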